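{- Let $P$ be an intersective integer polynomial of positive degree and let $D$ be a positive integer. Then the auxiliary polynomial $P_D$ is intersective.
   Context: A polynomial $P\in\mathbb{Z}[X]$ is intersective if for every positive integer $n$ there is an integer $x$ with $n\mid P(x)$ (equivalently, $P$ has a zero in $\mathbb{Z}_p$ for every prime $p$). Auxiliary polynomial: for each prime $p$ fix $z_p\in\mathbb{Z}_p$ with $P(z_p)=0$, and let $m_p\geq1$ be its multiplicity as a zero of $P$. Set $\lambda(D)=\prod_p p^{m_p\,\mathrm{ord}_p(D)}$. Let $r_D$ be the unique integer in $(-D,0]$ with $r_D\equiv z_p \pmod{p^{\mathrm{ord}_p(D)}\mathbb{Z}_p}$ for all primes $p$. Then $P_D(x)=P(r_D+Dx)/\lambda(D)$, which lies in $\mathbb{Z}[x]$. -}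

module Defs where

open import Data.Nat as ℕ using (ℕ; zero; suc)
open import Data.Nat.Divisibility as ℕD using (_∣?_; divides)
open import Data.Nat.Primality using (Prime; prime?)
open import Data.Integer as ℤ using (ℤ; +_; _+_; _*_; _-_; -_)
open import Data.Integer.DivMod using (_/ℕ_)
open import Data.Integer.Divisibility using (_∣_)
open import Data.List using (List; []; _∷_; foldr; map)
open import Data.Product using (∃; Σ; _×_)
open import Relation.Nullary using (¬_; yes; no)
open import Relation.Binary.PropositionalEquality using (_≡_)

-- Integer polynomials as coefficient lists, lowest degree first.

Poly : Set
Poly = List ℤ

eval : Poly → ℤ → ℤ
eval []       x = + 0
eval (a ∷ as) x = a + x * eval as x

coeff : Poly → ℕ → ℤ
coeff []       _       = + 0
coeff (a ∷ as) zero    = a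
coeff (a ∷ as) (suc i) = coeff as i

_⊕_ : Poly → Poly → Poly
[]       ⊕ q        = q
(a ∷ p)  ⊕ []       = a ∷ p
(a ∷ p)  ⊕ (b ∷ q)  = (a + b) ∷ (p ⊕ q)

scale : ℤ → Poly → Poly
scale c = map (c *_)

_⊗_ : Poly → Poly → Poly
[]      ⊗ q = []
(a ∷ p) ⊗ q = scale a q ⊕ (+ 0 ∷ (p ⊗ q))

compose : Poly → Poly → Poly
compose []       q = []
compose (a ∷ as) q = (a ∷ []) ⊕ (q ⊗ compose as q)

PositiveDegree : Poly → Set
PositiveDegree P = ∃ λ i → ¬ (coeff P (suc i) ≡ + 0)

Intersective : Poly → Set
Intersective P = (n : ℕ) → 1 ℕ.≤ n → ∃ λ (x : ℤ) → (+ n) ∣ eval P x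

-- p-adic integers, represented by coherent sequences of integer
-- approximations:  z k is the residue of z modulo p^k.

IsPadic : ℕ → (ℕ → ℤ) → Set
IsPadic p z = ∀ k → (+ (p ℕ.^ k)) ∣ (z (suc k) - z k)

PadicZeroAt : ℕ → Poly → (ℕ → ℤ) → Set
PadicZeroAt p Q z = ∀ k → (+ (p ℕ.^ k)) ∣ eval Q (z k)

-- j-th Taylor coefficient polynomial: coefficient of Y^j in P(X + Y),
-- as a polynomial in X (so its value at z is P^{(j)}(z)/j!).
taylorCoeffAt : Poly → ℕ → ℤ → ℤ
taylorCoeffAt P j x = coeff (compose P (x ∷ + 1 ∷ [])) j

-- z (a p-adic integer) is a zero of P of multiplicity exactly m:
-- in the expansion P(z + Y) = Σ c_j Y^j over ℤ_p, c_j = 0 for j < m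
-- and c_m ≠ 0 in ℤ_p.
IsZeroOfMultiplicity : ℕ → Poly → (ℕ → ℤ) → ℕ → Set
IsZeroOfMultiplicity p P z m =
  ((j : ℕ) → j ℕ.< m → ∀ k → (+ (p ℕ.^ k)) ∣ taylorCoeffAt P j (z k))
  × (∃ λ k → ¬ ((+ (p ℕ.^ k)) ∣ taylorCoeffAt P m (z k)))

-- p-adic valuation ord_p(n) of a natural number (intended for primes p,
-- n ≥ 1), computed with fuel n.

ordAux : ℕ → ℕ → ℕ → ℕ
ordAux zero       p n = 0
ordAux (suc fuel) p n with p ∣? n
... | yes (divides q _) = suc (ordAux fuel p q)
... | no  _             = 0

ord : ℕ → ℕ → ℕ
ord p zero    = 0
ord p (suc n) = ordAux (suc n) p (suc n)

-- λ(D) = ∏_p p^(m_p · ord_p D); only primes p ≤ D can divide D.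
lambdaAux : (ℕ → ℕ) → ℕ → ℕ → ℕ
lambdaAux m D zero    = 1
lambdaAux m D (suc p) with prime? (suc p)
... | yes _ = (suc p) ℕ.^ (m (suc p) ℕ.* ord (suc p) D) ℕ.* lambdaAux m D p
... | no  _ = lambdaAux m D p

lam : (ℕ → ℕ) → ℕ → ℕ
lam m D = lambdaAux m D D

-- integer division by a natural number (division by 0 gives 0; never
-- used since λ(D) ≥ 1)
divBy : ℤ → ℕ → ℤ
divBy a zero    = + 0
divBy a (suc k) = a /ℕ suc k

-- the auxiliary polynomial P_D(x) = P(r + D x) / λ(D), coefficientwise
auxPoly : Poly → (ℕ → ℕ) → ℕ → ℤ → Poly
auxPoly P m D r = map (λ c → divBy c (lam m D)) (compose P (r ∷ + D ∷ []))

{-# OPTIONS --safe #-}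
-- Fix a prime p, let e = ord_p D and m = m_p, and write Q(X) = P(r + D X). Since
-- r ≡ z_p (mod p^e) and p^e ∣ D, substituting r + D X for z_p + Y in the Taylor
-- expansion of P at (an approximation of) z_p, whose first m coefficients are
-- p-adically zero, shows that p^(m e) divides every coefficient of Q. Hence λ(D)
-- divides them and Q = λ(D) P_D. As D / p^e is a unit modulo p, the congruence
-- r + D x ≡ z_p (mod p^(e+a)) has a solution x, and then p^((e+a) m) ∣ Q(x) =
-- λ(D) P_D(x); since p^(m e) is the exact power of p in λ(D), p^a ∣ P_D(x).
-- The Chinese remainder theorem combines these prime-power solutions.
module Submission where

open import Defs
open import Data.Nat using (ℕ; _≤_; _^_)
open import Data.Nat.Primality using (Prime)
open import Data.Integer as ℤ using (ℤ; +_; -_; _-_)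
open import Data.Integer.Divisibility using (_∣_)

open import Data.Nat as ℕ using (zero; suc; _<_; z≤n; s≤s)
open import Data.Nat.Coprimality using (Coprime; coprime-divisor; coprime-Bézout)
open import Data.Nat.GCD using (module Bézout)
open import Data.Nat.Primality using (prime?; euclidsLemma; prime⇒irreducible; prime⇒nonTrivial; prime⇒nonZero)
open import Data.Nat.Primality.Factorisation using (factorise)
open import Data.Nat.ListAction using (product)
import Data.Nat.Tactic.RingSolver as NatSolver
open import Data.Nat.Induction using (<-rec)
import Data.Nat.Properties as ℕP
open import Data.Nat.Divisibility as ℕD using (_∤_; _∣?_) renaming (_∣_ to _∣ⁿ_)
open import Data.Integer using (_+_; _*_)
open import Data.Integer.DivMod using (_/ℕ_; _%ℕ_; a≡a%ℕn+[a/ℕn]*n; n%ℕd<d)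
import Data.Integer.Properties as ℤP
open import Data.Integer.Divisibility.Signed as S using () renaming (_∣_ to _∣ₛ_)
open import Data.Integer.Tactic.RingSolver using (solve-∀)
open import Data.List using ([]; _∷_; map)
open import Data.List.Relation.Unary.All using (All; []; _∷_)
open import Data.Product using (∃; _×_; _,_; proj₁)
open import Data.Sum using (inj₁; inj₂)
open import Data.Empty using (⊥-elim)
open import Relation.Nullary using (yes; no)
open import Relation.Binary.PropositionalEquality

∣∧<⇒≡0 : ∀ {m n} → m ∣ⁿ n → n < m → n ≡ 0
∣∧<⇒≡0 {n = zero}  _   _   = refl
∣∧<⇒≡0 {n = suc n} m∣n n<m = ⊥-elim (ℕD.>⇒∤ n<m m∣n)

eval-⊕ : ∀ p q x → eval (p ⊕ q) x ≡ eval p x + eval q x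
eval-⊕ []      q       x = sym (ℤP.+-identityˡ _)
eval-⊕ (a ∷ p) []      x = sym (ℤP.+-identityʳ _)
eval-⊕ (a ∷ p) (b ∷ q) x rewrite eval-⊕ p q x = ring a b x (eval p x) (eval q x)
  where
  ring : ∀ a b x u v → a + b + x * (u + v) ≡ a + x * u + (b + x * v)
  ring = solve-∀

eval-scale : ∀ c p x → eval (scale c p) x ≡ c * eval p x
eval-scale c []      x = sym (ℤP.*-zeroʳ c)
eval-scale c (a ∷ p) x rewrite eval-scale c p x = ring c a x (eval p x)
  where
  ring : ∀ c a x u → c * a + x * (c * u) ≡ c * (a + x * u)
  ring = solve-∀

eval-⊗ : ∀ p q x → eval (p ⊗ q) x ≡ eval p x * eval q x
eval-⊗ []      q x = refl
eval-⊗ (a ∷ p) q x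
  rewrite eval-⊕ (scale a q) (+ 0 ∷ (p ⊗ q)) x | eval-scale a q x | eval-⊗ p q x
  = ring a x (eval p x) (eval q x)
  where
  ring : ∀ a x u v → a * v + (+ 0 + x * (u * v)) ≡ (a + x * u) * v
  ring = solve-∀

eval-compose : ∀ p q x → eval (compose p q) x ≡ eval p (eval q x)
eval-compose []      q x = refl
eval-compose (a ∷ p) q x
  rewrite eval-⊕ (a ∷ []) (q ⊗ compose p q) x | eval-⊗ q (compose p q) x
        | eval-compose p q x
  = ring a x (eval q x) (eval p (eval q x))
  where
  ring : ∀ a x u v → a + x * + 0 + u * v ≡ a + u * v
  ring = solve-∀

eval-linear : ∀ a b x → eval (a ∷ b ∷ []) x ≡ a + x * b
eval-linear a b x = cong (λ t → a + x * t) (ring b x)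
  where
  ring : ∀ b x → b + x * + 0 ≡ b
  ring = solve-∀

eval-compose-linear : ∀ p a b x → eval (compose p (a ∷ b ∷ [])) x ≡ eval p (a + x * b)
eval-compose-linear p a b x = trans (eval-compose p (a ∷ b ∷ []) x) (cong (eval p) (eval-linear a b x))

eval-cong-∣ : ∀ {N} p {a b} → N ∣ₛ a - b → N ∣ₛ eval p a - eval p b
eval-cong-∣ []      _ = S.divides (+ 0) refl
eval-cong-∣ {N} (c ∷ p) {a} {b} N∣a-b =
  subst (N ∣ₛ_) (ring c a b (eval p a) (eval p b))
    (S.∣m∣n⇒∣m+n (S.∣m⇒∣m*n (eval p a) N∣a-b) (S.∣n⇒∣m*n b (eval-cong-∣ p N∣a-b)))
  where
  ring : ∀ c a b u v → (a - b) * u + b * (u - v) ≡ c + a * u - (c + b * v)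
  ring = solve-∀

coeff-⊕ : ∀ p q j → coeff (p ⊕ q) j ≡ coeff p j + coeff q j
coeff-⊕ []      q       j       = sym (ℤP.+-identityˡ _)
coeff-⊕ (a ∷ p) []      j       = sym (ℤP.+-identityʳ _)
coeff-⊕ (a ∷ p) (b ∷ q) zero    = refl
coeff-⊕ (a ∷ p) (b ∷ q) (suc j) = coeff-⊕ p q j

coeff-scale : ∀ c p j → coeff (scale c p) j ≡ c * coeff p j
coeff-scale c []      j       = sym (ℤP.*-zeroʳ c)
coeff-scale c (a ∷ p) zero    = refl
coeff-scale c (a ∷ p) (suc j) = coeff-scale c p j

-- The identity principle

coeff-vanishing : ∀ p → (∀ n → eval p (+ suc n) ≡ + 0) → ∀ j → coeff p j ≡ + 0
coeff-vanishing []      _      _       = refl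
coeff-vanishing (c ∷ p) vanish zero    =
  ℤP.∣i∣≡0⇒i≡0 (∣∧<⇒≡0 (S.∣⇒∣ᵤ x∣c) (ℕP.n<1+n _))
  where
  -- evaluating at x = 1 + ∣c∣ exhibits c as a multiple of an integer larger than ∣c∣
  x = + suc ℤ.∣ c ∣
  x∣value : x ∣ₛ c + x * eval p x
  x∣value = subst (x ∣ₛ_) (sym (vanish ℤ.∣ c ∣)) (S.divides (+ 0) refl)
  x∣c : x ∣ₛ c
  x∣c = S.∣m+n∣n⇒∣m x∣value (S.∣m⇒∣m*n (eval p x) S.∣-refl)
coeff-vanishing (c ∷ p) vanish (suc j) = coeff-vanishing p tail-vanish j
  where
  c≡0 : c ≡ + 0
  c≡0 = coeff-vanishing (c ∷ p) vanish zero
  tail-vanish : ∀ n → eval p (+ suc n) ≡ + 0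
  tail-vanish n with ℤP.i*j≡0⇒i≡0∨j≡0 (+ suc n)
         (trans (sym (ℤP.+-identityˡ _)) (subst (λ t → t + _ ≡ + 0) c≡0 (vanish n)))
  ... | inj₂ e≡0 = e≡0

coeff-unique : ∀ p q → (∀ n → eval p (+ suc n) ≡ eval q (+ suc n)) → ∀ j → coeff p j ≡ coeff q j
coeff-unique p q agree j = ℤP.i-j≡0⇒i≡j _ _ (begin
  coeff p j - coeff q j           ≡⟨ coeff-difference j ⟨
  coeff (p ⊕ scale ℤ.-1ℤ q) j     ≡⟨ coeff-vanishing (p ⊕ scale ℤ.-1ℤ q) difference-vanishes j ⟩
  + 0                             ∎)
  where
  open ≡-Reasoning
  coeff-difference : ∀ j → coeff (p ⊕ scale ℤ.-1ℤ q) j ≡ coeff p j - coeff q j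
  coeff-difference j = trans (coeff-⊕ p _ j)
    (cong (λ t → coeff p j + t) (trans (coeff-scale ℤ.-1ℤ q j) (ℤP.-1*i≡-i _)))
  difference-vanishes : ∀ n → eval (p ⊕ scale ℤ.-1ℤ q) (+ suc n) ≡ + 0
  difference-vanishes n = begin
    eval (p ⊕ scale ℤ.-1ℤ q) x          ≡⟨ eval-⊕ p _ x ⟩
    eval p x + eval (scale ℤ.-1ℤ q) x   ≡⟨ cong (λ t → eval p x + t) (eval-scale ℤ.-1ℤ q x) ⟩
    eval p x + ℤ.-1ℤ * eval q x         ≡⟨ cong (λ t → eval p x + t) (ℤP.-1*i≡-i _) ⟩
    eval p x - eval q x                 ≡⟨ cong (_- eval q x) (agree n) ⟩
    eval q x - eval q x                 ≡⟨ ℤP.+-inverseʳ (eval q x) ⟩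
    + 0                                 ∎
    where x = + suc n

infix 4 _∣ₚ_

_∣ₚ_ : ℤ → Poly → Set
d ∣ₚ p = All (d ∣ₛ_) p

∣ₚ⇒∣coeff : ∀ {d} p → d ∣ₚ p → ∀ j → d ∣ₛ coeff p j
∣ₚ⇒∣coeff []      []         j       = S.divides (+ 0) refl
∣ₚ⇒∣coeff (a ∷ p) (d∣a ∷ _)  zero    = d∣a
∣ₚ⇒∣coeff (a ∷ p) (_ ∷ d∣p)  (suc j) = ∣ₚ⇒∣coeff p d∣p j

∣coeff⇒∣ₚ : ∀ {d} p → (∀ j → d ∣ₛ coeff p j) → d ∣ₚ p
∣coeff⇒∣ₚ []      _     = []
∣coeff⇒∣ₚ (a ∷ p) d∣cfs = d∣cfs zero ∷ ∣coeff⇒∣ₚ p (λ j → d∣cfs (suc j))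

∣ₚ⇒∣eval : ∀ {d} p x → d ∣ₚ p → d ∣ₛ eval p x
∣ₚ⇒∣eval []      x []          = S.divides (+ 0) refl
∣ₚ⇒∣eval (a ∷ p) x (d∣a ∷ d∣p) = S.∣m∣n⇒∣m+n d∣a (S.∣n⇒∣m*n x (∣ₚ⇒∣eval p x d∣p))

∣ₚ-⊕ : ∀ {d} p q → d ∣ₚ p → d ∣ₚ q → d ∣ₚ p ⊕ q
∣ₚ-⊕ []      q       _           d∣q         = d∣q
∣ₚ-⊕ (a ∷ p) []      d∣p         _           = d∣p
∣ₚ-⊕ (a ∷ p) (b ∷ q) (d∣a ∷ d∣p) (d∣b ∷ d∣q) = S.∣m∣n⇒∣m+n d∣a d∣b ∷ ∣ₚ-⊕ p q d∣p d∣q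

*-pres-∣ₛ : ∀ {d e a b} → d ∣ₛ a → e ∣ₛ b → d * e ∣ₛ a * b
*-pres-∣ₛ {d} {e} (S.divides q refl) (S.divides q′ refl) = S.divides (q * q′) (ring q d q′ e)
  where
  ring : ∀ q d q′ e → q * d * (q′ * e) ≡ q * q′ * (d * e)
  ring = solve-∀

∣ₚ-scale : ∀ {d e c} q → d ∣ₛ c → e ∣ₚ q → d * e ∣ₚ scale c q
∣ₚ-scale []      d∣c []          = []
∣ₚ-scale (b ∷ q) d∣c (e∣b ∷ e∣q) = *-pres-∣ₛ d∣c e∣b ∷ ∣ₚ-scale q d∣c e∣q

∣ₚ-⊗ : ∀ {d e} p q → d ∣ₚ p → e ∣ₚ q → d * e ∣ₚ p ⊗ q
∣ₚ-⊗ []      q []          e∣q = []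
∣ₚ-⊗ (a ∷ p) q (d∣a ∷ d∣p) e∣q =
  ∣ₚ-⊕ (scale a q) (+ 0 ∷ (p ⊗ q)) (∣ₚ-scale q d∣a e∣q) (S.divides (+ 0) refl ∷ ∣ₚ-⊗ p q d∣p e∣q)

-- The term t_i L^i of T ∘ L is divisible by M ^ m through t_i if i < m,
-- and through L^i otherwise.
∣ₚ-compose : ∀ {M} m T L → M ∣ₚ L → (∀ i → i < m → M ℤ.^ m ∣ₛ coeff T i) →
             M ℤ.^ m ∣ₚ compose T L
∣ₚ-compose m       []      L M∣L low = []
∣ₚ-compose zero    (t ∷ T) L M∣L low =
  ∣coeff⇒∣ₚ (compose (t ∷ T) L)
    (λ j → S.divides (coeff (compose (t ∷ T) L) j) (sym (ℤP.*-identityʳ _)))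
∣ₚ-compose {M} (suc m) (t ∷ T) L M∣L low =
  ∣ₚ-⊕ (t ∷ []) (L ⊗ compose T L) (low zero (s≤s z≤n) ∷ [])
    (∣ₚ-⊗ L (compose T L) M∣L (∣ₚ-compose m T L M∣L low′))
  where
  low′ : ∀ i → i < m → M ℤ.^ m ∣ₛ coeff T i
  low′ i i<m = S.∣-trans (S.divides M refl) (low (suc i) (s≤s i<m))

∣ₚ-transfer : ∀ {d} p q → (∀ n → eval p (+ suc n) ≡ eval q (+ suc n)) → d ∣ₚ q → d ∣ₚ p
∣ₚ-transfer {d} p q agree d∣q =
  ∣coeff⇒∣ₚ p (λ j → subst (d ∣ₛ_) (sym (coeff-unique p q agree j)) (∣ₚ⇒∣coeff q d∣q j))

∣ₚ-linear-substitution : ∀ {M} m P c a b →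
                         (∀ i → i < m → M ℤ.^ m ∣ₛ taylorCoeffAt P i c) →
                         M ∣ₛ a - c → M ∣ₛ b → M ℤ.^ m ∣ₚ compose P (a ∷ b ∷ [])
∣ₚ-linear-substitution m P c a b low M∣a-c M∣b =
  ∣ₚ-transfer (compose P (a ∷ b ∷ [])) (compose T L) agree
    (∣ₚ-compose m T L (M∣a-c ∷ M∣b ∷ []) low)
  where
  T = compose P (c ∷ + 1 ∷ [])
  L = (a - c) ∷ b ∷ []
  agree : ∀ n → eval (compose P (a ∷ b ∷ [])) (+ suc n) ≡ eval (compose T L) (+ suc n)
  agree n = begin
    eval (compose P (a ∷ b ∷ [])) x       ≡⟨ eval-compose-linear P a b x ⟩
    eval P (a + x * b)                    ≡⟨ cong (eval P) (ring a b c x) ⟩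
    eval P (c + (a - c + x * b) * + 1)    ≡⟨ eval-compose-linear P c (+ 1) (a - c + x * b) ⟨
    eval T (a - c + x * b)                ≡⟨ cong (eval T) (eval-linear (a - c) b x) ⟨
    eval T (eval L x)                     ≡⟨ eval-compose T L x ⟨
    eval (compose T L) x                  ∎
    where
    open ≡-Reasoning
    x = + suc n
    ring : ∀ a b c x → a + x * b ≡ c + (a - c + x * b) * + 1
    ring = solve-∀

divBy-exact : ∀ c k → + suc k ∣ₛ c → divBy c (suc k) * + suc k ≡ c
divBy-exact c k n∣c = begin
  c /ℕ n * + n                  ≡⟨ ℤP.+-identityˡ _ ⟨
  + 0 + c /ℕ n * + n            ≡⟨ cong (λ t → t + c /ℕ n * + n) remainder≡0 ⟨
  + (c %ℕ n) + c /ℕ n * + n     ≡⟨ a≡a%ℕn+[a/ℕn]*n c n ⟨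
  c                             ∎
  where
  open ≡-Reasoning
  n = suc k
  n∣remainder : + n ∣ₛ + (c %ℕ n)
  n∣remainder = S.∣m+n∣n⇒∣m (subst (+ n ∣ₛ_) (a≡a%ℕn+[a/ℕn]*n c n) n∣c)
                             (S.∣n⇒∣m*n (c /ℕ n) S.∣-refl)
  remainder≡0 : + (c %ℕ n) ≡ + 0
  remainder≡0 = cong +_ (∣∧<⇒≡0 (S.∣⇒∣ᵤ n∣remainder) (n%ℕd<d c n))

eval-divBy : ∀ n → 1 ≤ n → ∀ q → + n ∣ₚ q → ∀ x → eval q x ≡ eval (map (λ c → divBy c n) q) x * + n
eval-divBy (suc k) _   []      []          x = refl
eval-divBy (suc k) n≥1 (c ∷ q) (n∣c ∷ n∣q) x = begin
  c + x * eval q x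
    ≡⟨ cong₂ (λ u v → u + x * v) (divBy-exact c k n∣c) (sym (eval-divBy (suc k) n≥1 q n∣q x)) ⟨
  divBy c n * + n + x * (eval (map cut q) x * + n)    ≡⟨ ring (divBy c n) x (eval (map cut q) x) (+ n) ⟩
  eval (map cut (c ∷ q)) x * + n                      ∎
  where
  open ≡-Reasoning
  n = suc k
  cut : ℤ → ℤ
  cut c = divBy c n
  ring : ∀ a x u n → a * n + x * (u * n) ≡ (a + x * u) * n
  ring = solve-∀

prime>1 : ∀ {p} → Prime p → 1 < p
prime>1 {p} p-prime = ℕ.nonTrivial⇒n>1 p {{prime⇒nonTrivial p-prime}}

prime∤1 : ∀ {p} → Prime p → p ∤ 1
prime∤1 p-prime p∣1 = ℕP.<-irrefl (sym (ℕD.∣1⇒≡1 p∣1)) (prime>1 p-prime)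

prime∤* : ∀ {p a b} → Prime p → p ∤ a → p ∤ b → p ∤ a ℕ.* b
prime∤* {a = a} {b} p-prime p∤a p∤b p∣ab with euclidsLemma a b p-prime p∣ab
... | inj₁ p∣a = p∤a p∣a
... | inj₂ p∣b = p∤b p∣b

prime∣prime^⇒≡ : ∀ {p q} → Prime p → Prime q → ∀ k → p ∣ⁿ q ^ k → p ≡ q
prime∣prime^⇒≡ p-prime q-prime zero    p∣1 = ⊥-elim (prime∤1 p-prime p∣1)
prime∣prime^⇒≡ {p} {q} p-prime q-prime (suc k) p∣q^k+1 with euclidsLemma q (q ^ k) p-prime p∣q^k+1
... | inj₂ p∣q^k = prime∣prime^⇒≡ p-prime q-prime k p∣q^k
... | inj₁ p∣q with prime⇒irreducible q-prime p∣q
...   | inj₁ refl = ⊥-elim (ℕP.<-irrefl refl (prime>1 p-prime))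
...   | inj₂ p≡q  = p≡q

prime∤prime^ : ∀ {p q} → Prime p → Prime q → p ≢ q → ∀ k → p ∤ q ^ k
prime∤prime^ p-prime q-prime p≢q k p∣q^k = p≢q (prime∣prime^⇒≡ p-prime q-prime k p∣q^k)

∃-prime-divisor : ∀ n → 1 < n → ∃ λ p → Prime p × p ∣ⁿ n
∃-prime-divisor n n>1 with factorise n {{ℕ.>-nonZero (ℕP.<-trans (s≤s z≤n) n>1)}}
... | record { factors = [] ; isFactorisation = n≡1 } = ⊥-elim (ℕP.<-irrefl (sym n≡1) n>1)
... | record { factors = p ∷ ps ; isFactorisation = n≡p*ps ; factorsPrime = p-prime ∷ _ } =
  p , p-prime , ℕD.divides (product ps) (trans n≡p*ps (ℕP.*-comm p (product ps)))

coprime-prime^ : ∀ {p b} → Prime p → p ∤ b → ∀ k → Coprime (p ^ k) b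
coprime-prime^ {p} p-prime p∤b k {zero}        (_ , 0∣b)
  with refl ← ℕD.0∣⇒≡0 0∣b = ⊥-elim (p∤b (p ℕD.∣0))
coprime-prime^          p-prime p∤b k {1}           _ = refl
coprime-prime^          p-prime p∤b k {suc (suc d)} (d∣p^k , d∣b)
  with q , q-prime , q∣d ← ∃-prime-divisor (suc (suc d)) (s≤s (s≤s z≤n))
  with refl ← prime∣prime^⇒≡ q-prime p-prime k (ℕD.∣-trans q∣d d∣p^k)
  = ⊥-elim (p∤b (ℕD.∣-trans q∣d d∣b))

^-monoʳ-∣ : ∀ p {m n} → m ≤ n → p ^ m ∣ⁿ p ^ n
^-monoʳ-∣ p {m} {n} m≤n = ℕD.divides (p ^ (n ℕ.∸ m))
  (trans (cong (p ^_) (sym (ℕP.m∸n+n≡m m≤n))) (ℕP.^-distribˡ-+-* p (n ℕ.∸ m) m))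

coprime-∣-* : ∀ {M N t} → Coprime M N → M ∣ⁿ t → N ∣ⁿ t → M ℕ.* N ∣ⁿ t
coprime-∣-* {M} {N} coprime M∣t (ℕD.divides q refl) =
  ℕD.*-monoˡ-∣ N (coprime-divisor coprime (subst (M ∣ⁿ_) (ℕP.*-comm q N) M∣t))

ordAux-spec : ∀ {p} → Prime p → ∀ fuel n → 1 ≤ n → n ≤ fuel →
              ∃ λ b → n ≡ p ^ ordAux fuel p n ℕ.* b × p ∤ b
ordAux-spec p-prime zero n n≥1 n≤0 = ⊥-elim (ℕP.<-irrefl refl (ℕP.≤-trans n≥1 n≤0))
ordAux-spec {p} p-prime (suc fuel) n n≥1 n≤fuel+1 with p ∣? n
... | no  p∤n = n , sym (ℕP.+-identityʳ n) , p∤n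
... | yes (ℕD.divides q refl) =
  step (ordAux-spec p-prime fuel q q≥1 (ℕP.≤-pred (ℕP.<-≤-trans q<n n≤fuel+1)))
  where
  q≥1 : 1 ≤ q
  q≥1 = ℕP.n≢0⇒n>0 (λ { refl → ℕP.<-irrefl refl n≥1 })
  q<n : q < q ℕ.* p
  q<n = ℕP.m<m*n q p {{ℕ.>-nonZero q≥1}} (prime>1 p-prime)
  step : (∃ λ b → q ≡ p ^ ordAux fuel p q ℕ.* b × p ∤ b) →
         ∃ λ b → q ℕ.* p ≡ p ^ suc (ordAux fuel p q) ℕ.* b × p ∤ b
  step (b , q≡p^o*b , p∤b) = b , trans (cong (ℕ._* p) q≡p^o*b) (ring p (p ^ ordAux fuel p q) b) , p∤b
    where
    ring : ∀ p x b → x ℕ.* b ℕ.* p ≡ p ℕ.* x ℕ.* b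
    ring = NatSolver.solve-∀

ord-spec : ∀ {p} → Prime p → ∀ n → 1 ≤ n → ∃ λ b → n ≡ p ^ ord p n ℕ.* b × p ∤ b
ord-spec p-prime (suc n) n≥1 = ordAux-spec p-prime (suc n) (suc n) n≥1 ℕP.≤-refl

ord≡0 : ∀ {p} → Prime p → ∀ n → 1 ≤ n → n < p → ord p n ≡ 0
ord≡0 {p} p-prime n n≥1 n<p with ord-spec p-prime n n≥1
... | b , n≡p^o*b , _ with ord p n
...   | zero  = refl
...   | suc o = ⊥-elim (ℕP.<⇒≱ n<p (ℕD.∣⇒≤ {{ℕ.>-nonZero n≥1}} p∣n))
  where
  p∣n : p ∣ⁿ n
  p∣n = subst (p ∣ⁿ_) (sym n≡p^o*b) (ℕD.∣m⇒∣m*n b (ℕD.m∣m*n (p ^ o)))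

prime-power-∣-cancel : ∀ {p l} → Prime p → p ∤ l → ∀ {k e a v} → 1 ≤ k →
                       p ^ ((e ℕ.+ a) ℕ.* k) ∣ⁿ v ℕ.* (p ^ (k ℕ.* e) ℕ.* l) → p ^ a ∣ⁿ v
prime-power-∣-cancel {p} {l} p-prime p∤l {k} {e} {a} {v} k≥1 p^[e+a]k∣v*p^ke*l =
  ℕD.∣-trans (^-monoʳ-∣ p (ℕP.m≤m*n a k {{ℕ.>-nonZero k≥1}}))
    (coprime-divisor (coprime-prime^ p-prime p∤l (a ℕ.* k))
      (ℕD.*-cancelˡ-∣ (p ^ (k ℕ.* e)) {{ℕ.>-nonZero (ℕP.m^n>0 p {{prime⇒nonZero p-prime}} (k ℕ.* e))}}
        (subst₂ _∣ⁿ_ split rearrange p^[e+a]k∣v*p^ke*l)))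
  where
  split : p ^ ((e ℕ.+ a) ℕ.* k) ≡ p ^ (k ℕ.* e) ℕ.* p ^ (a ℕ.* k)
  split = trans (cong (p ^_) (ring e a k)) (ℕP.^-distribˡ-+-* p (k ℕ.* e) (a ℕ.* k))
    where
    ring : ∀ e a k → (e ℕ.+ a) ℕ.* k ≡ k ℕ.* e ℕ.+ a ℕ.* k
    ring = NatSolver.solve-∀
  rearrange : v ℕ.* (p ^ (k ℕ.* e) ℕ.* l) ≡ p ^ (k ℕ.* e) ℕ.* (l ℕ.* v)
  rearrange = ring v (p ^ (k ℕ.* e)) l
    where
    ring : ∀ v x l → v ℕ.* (x ℕ.* l) ≡ x ℕ.* (l ℕ.* v)
    ring = NatSolver.solve-∀

pos-1+*≡* : ∀ a b c d → 1 ℕ.+ a ℕ.* b ≡ c ℕ.* d → + 1 + + a * + b ≡ + c * + d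
pos-1+*≡* a b c d eq = begin
  + 1 + + a * + b       ≡⟨ cong (λ t → + 1 + t) (ℤP.pos-* a b) ⟨
  + (1 ℕ.+ a ℕ.* b)     ≡⟨ cong +_ eq ⟩
  + (c ℕ.* d)           ≡⟨ ℤP.pos-* c d ⟩
  + c * + d             ∎
  where open ≡-Reasoning

coprime⇒invertible : ∀ {A B} → Coprime A B → ∃ λ α → + A ∣ₛ + B * α - + 1
coprime⇒invertible {A} {B} coprime with coprime-Bézout coprime
... | Bézout.+- x y eq = - + y , S.divides (- + x) (begin
  + B * - + y - + 1     ≡⟨ ring₁ (+ y) (+ B) ⟩
  - (+ 1 + + y * + B)   ≡⟨ cong -_ (pos-1+*≡* y B x A eq) ⟩
  - (+ x * + A)         ≡⟨ ℤP.neg-distribˡ-* (+ x) (+ A) ⟩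
  - + x * + A           ∎)
  where
  open ≡-Reasoning
  ring₁ : ∀ y B → B * - y - + 1 ≡ - (+ 1 + y * B)
  ring₁ = solve-∀
... | Bézout.-+ x y eq = + y , S.divides (+ x) (begin
  + B * + y - + 1       ≡⟨ cong (_- + 1) (ℤP.*-comm (+ B) (+ y)) ⟩
  + y * + B - + 1       ≡⟨ cong (_- + 1) (pos-1+*≡* x A y B eq) ⟨
  + 1 + + x * + A - + 1 ≡⟨ ring₂ (+ x * + A) ⟩
  + x * + A             ∎)
  where
  open ≡-Reasoning
  ring₂ : ∀ u → + 1 + u - + 1 ≡ u
  ring₂ = solve-∀

crt : ∀ {M N} → Coprime M N → ∀ x₁ x₂ → ∃ λ x → + M ∣ₛ x - x₁ × + N ∣ₛ x - x₂
crt {M} {N} coprime x₁ x₂ with coprime⇒invertible coprime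
... | α , S.divides β Nα≡1 =
  x , S.divides (β * (x₁ - x₂)) M∣x-x₁ , S.divides (α * (x₁ - x₂)) (ring₂ x₁ x₂ (+ N) α)
  where
  x = x₂ + + N * α * (x₁ - x₂)
  M∣x-x₁ : x - x₁ ≡ β * (x₁ - x₂) * + M
  M∣x-x₁ = trans (ring₁ x₁ x₂ (+ N) α) (trans (cong (_* (x₁ - x₂)) Nα≡1) (ring₃ β (+ M) (x₁ - x₂)))
    where
    ring₁ : ∀ x₁ x₂ N α → x₂ + N * α * (x₁ - x₂) - x₁ ≡ (N * α - + 1) * (x₁ - x₂)
    ring₁ = solve-∀
    ring₃ : ∀ b M d → b * M * d ≡ b * d * M
    ring₃ = solve-∀
  ring₂ : ∀ x₁ x₂ N α → x₂ + N * α * (x₁ - x₂) - x₂ ≡ α * (x₁ - x₂) * N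
  ring₂ = solve-∀

-- From prime powers to all moduli

HasZeroMod : Poly → ℕ → Set
HasZeroMod A n = ∃ λ x → + n ∣ eval A x

∣-eval-cong : ∀ A {K y y′} → + K ∣ₛ y - y′ → + K ∣ eval A y′ → + K ∣ eval A y
∣-eval-cong A {y = y} {y′} K∣y-y′ K∣A[y′] = S.∣⇒∣ᵤ (subst (_ ∣ₛ_) (ring (eval A y) (eval A y′))
  (S.∣m∣n⇒∣m+n (eval-cong-∣ A K∣y-y′) (S.∣ᵤ⇒∣ K∣A[y′])))
  where
  ring : ∀ u v → u - v + v ≡ u
  ring = solve-∀

hasZeroMod-* : ∀ A {M N} → Coprime M N → HasZeroMod A M → HasZeroMod A N → HasZeroMod A (M ℕ.* N)
hasZeroMod-* A {M} {N} coprime (x₁ , M∣A[x₁]) (x₂ , N∣A[x₂]) = combine (crt coprime x₁ x₂)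
  where
  combine : (∃ λ x → + M ∣ₛ x - x₁ × + N ∣ₛ x - x₂) → HasZeroMod A (M ℕ.* N)
  combine (x , M∣x-x₁ , N∣x-x₂) =
    x , coprime-∣-* coprime (∣-eval-cong A M∣x-x₁ M∣A[x₁]) (∣-eval-cong A N∣x-x₂ N∣A[x₂])

prime-power-zeros⇒intersective : ∀ A → (∀ p → Prime p → ∀ a → HasZeroMod A (p ^ a)) → Intersective A
prime-power-zeros⇒intersective A local = <-rec (λ n → 1 ≤ n → HasZeroMod A n) step
  where
  peel-prime-power : ∀ {n p} → 1 ≤ n → Prime p → p ∣ⁿ n → (∀ {k} → k < n → 1 ≤ k → HasZeroMod A k) →
          (∃ λ b → n ≡ p ^ ord p n ℕ.* b × p ∤ b) → HasZeroMod A n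
  peel-prime-power {n} {p} n≥1 p-prime p∣n rec (b , n≡p^o*b , p∤b) = subst (HasZeroMod A) (sym n≡p^o*b)
    (hasZeroMod-* A (coprime-prime^ p-prime p∤b o) (local p p-prime o) (rec b<n b≥1))
    where
    o = ord p n
    o≢0 : o ≢ 0
    o≢0 o≡0 = p∤b (subst (p ∣ⁿ_) n≡b p∣n)
      where
      n≡b : n ≡ b
      n≡b = trans n≡p^o*b (trans (cong (λ k → p ^ k ℕ.* b) o≡0) (ℕP.+-identityʳ b))
    b≥1 : 1 ≤ b
    b≥1 = ℕP.n≢0⇒n>0 (λ { refl → ℕP.<⇒≢ n≥1 (sym (trans n≡p^o*b (ℕP.*-zeroʳ (p ^ o)))) })
    b<n : b < n
    b<n = subst (b <_) (trans (ℕP.*-comm b (p ^ o)) (sym n≡p^o*b))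
            (ℕP.m<m*n b (p ^ o) {{ℕ.>-nonZero b≥1}} (ℕP.^-monoʳ-< p (prime>1 p-prime) (ℕP.n≢0⇒n>0 o≢0)))
  step : ∀ n → (∀ {k} → k < n → 1 ≤ k → HasZeroMod A k) → 1 ≤ n → HasZeroMod A n
  step 1                  _   _ = + 0 , ℕD.1∣ _
  step n@(suc (suc _)) rec n≥1 with ∃-prime-divisor n (s≤s (s≤s z≤n))
  ... | p , p-prime , p∣n = peel-prime-power n≥1 p-prime p∣n rec (ord-spec p-prime n n≥1)

-- The normalising factor λ(D)

module _ (m : ℕ → ℕ) (D : ℕ) where

  lam-exponent : ℕ → ℕ
  lam-exponent p = m p ℕ.* ord p D

  lambdaAux-coprime : ∀ {p} → Prime p → ∀ B → B < p → p ∤ lambdaAux m D B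
  lambdaAux-coprime p-prime zero    _     = prime∤1 p-prime
  lambdaAux-coprime p-prime (suc b) b+1<p with prime? (suc b)
  ... | no  _       = lambdaAux-coprime p-prime b (ℕP.<-trans (ℕP.n<1+n b) b+1<p)
  ... | yes b+1-prime =
    prime∤* p-prime
      (prime∤prime^ p-prime b+1-prime (λ { refl → ℕP.<-irrefl refl b+1<p }) (lam-exponent (suc b)))
      (lambdaAux-coprime p-prime b (ℕP.<-trans (ℕP.n<1+n b) b+1<p))

  lambdaAux-split : ∀ {p} → Prime p → ∀ B → p ≤ B →
                    ∃ λ l → lambdaAux m D B ≡ p ^ lam-exponent p ℕ.* l × p ∤ l
  lambdaAux-split p-prime zero    z≤n = ⊥-elim (ℕP.n≮0 (prime>1 p-prime))
  lambdaAux-split {p} p-prime (suc b) p≤b+1 with prime? (suc b) | ℕP.m≤n⇒m<n∨m≡n p≤b+1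
  ... | yes _ | inj₂ refl = lambdaAux m D b , refl , lambdaAux-coprime p-prime b ℕP.≤-refl
  ... | no  b+1-not-prime | inj₂ refl = ⊥-elim (b+1-not-prime p-prime)
  ... | no  _ | inj₁ p<b+1 = lambdaAux-split p-prime b (ℕP.≤-pred p<b+1)
  ... | yes b+1-prime | inj₁ p<b+1 with l , eq , p∤l ← lambdaAux-split p-prime b (ℕP.≤-pred p<b+1) =
    q^k ℕ.* l , trans (cong (q^k ℕ.*_) eq) (ring q^k (p ^ lam-exponent p) l) ,
    prime∤* p-prime
      (prime∤prime^ p-prime b+1-prime (λ { refl → ℕP.<-irrefl refl p<b+1 }) (lam-exponent (suc b))) p∤l
    where
    q^k = suc b ^ lam-exponent (suc b)
    ring : ∀ x y z → x ℕ.* (y ℕ.* z) ≡ y ℕ.* (x ℕ.* z)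
    ring = NatSolver.solve-∀

  lambdaAux-∣ : ∀ {c} → (∀ p → Prime p → p ^ lam-exponent p ∣ⁿ c) → ∀ B → lambdaAux m D B ∣ⁿ c
  lambdaAux-∣ p^∣c zero    = ℕD.1∣ _
  lambdaAux-∣ p^∣c (suc b) with prime? (suc b)
  ... | no  _           = lambdaAux-∣ p^∣c b
  ... | yes b+1-prime =
    coprime-∣-* (coprime-prime^ b+1-prime (lambdaAux-coprime b+1-prime b ℕP.≤-refl) (lam-exponent (suc b)))
      (p^∣c (suc b) b+1-prime) (lambdaAux-∣ p^∣c b)

  lambdaAux-positive : ∀ B → 1 ≤ lambdaAux m D B
  lambdaAux-positive zero    = ℕP.≤-refl
  lambdaAux-positive (suc b) with prime? (suc b)
  ... | no  _ = lambdaAux-positive b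
  ... | yes _ = ℕP.*-mono-≤ (ℕP.m^n>0 (suc b) (lam-exponent (suc b))) (lambdaAux-positive b)

  lam-split : 1 ≤ D → ∀ {p} → Prime p → ∃ λ l → lam m D ≡ p ^ lam-exponent p ℕ.* l × p ∤ l
  lam-split D≥1 {p} p-prime with p ℕP.≤? D
  ... | yes p≤D = lambdaAux-split p-prime D p≤D
  ... | no  p≰D = lam m D , lam≡p^0*lam , lambdaAux-coprime p-prime D (ℕP.≰⇒> p≰D)
    where
    lam≡p^0*lam : lam m D ≡ p ^ lam-exponent p ℕ.* lam m D
    lam≡p^0*lam = begin
      lam m D                        ≡⟨ ℕP.*-identityˡ (lam m D) ⟨
      1 ℕ.* lam m D                  ≡⟨ cong (λ k → p ^ k ℕ.* lam m D) (ℕP.*-zeroʳ (m p)) ⟨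
      p ^ (m p ℕ.* 0) ℕ.* lam m D
        ≡⟨ cong (λ o → p ^ (m p ℕ.* o) ℕ.* lam m D) (ord≡0 p-prime D D≥1 (ℕP.≰⇒> p≰D)) ⟨
      p ^ lam-exponent p ℕ.* lam m D     ∎
      where open ≡-Reasoning

-- Approximate zeros modulo prime powers

pos-^ : ∀ a n → (+ a) ℤ.^ n ≡ + (a ^ n)
pos-^ a zero    = refl
pos-^ a (suc n) = trans (cong (λ t → + a * t) (pos-^ a n)) (sym (ℤP.pos-* a (a ^ n)))

pos-^-^ : ∀ p n k → (+ (p ^ n)) ℤ.^ k ≡ + (p ^ (n ℕ.* k))
pos-^-^ p n k = trans (pos-^ (p ^ n) k) (cong +_ (ℕP.^-*-assoc p n k))

padic-coherent : ∀ {p z} → IsPadic p z → ∀ {k K} → k ≤ K → + (p ^ k) ∣ₛ z K - z k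
padic-coherent {p} {z} padic {k} k≤K = go (ℕP.≤⇒≤′ k≤K)
  where
  go : ∀ {K} → k ℕ.≤′ K → + (p ^ k) ∣ₛ z K - z k
  go (ℕ.≤′-reflexive refl) = S.divides (+ 0) (ℤP.+-inverseʳ (z k))
  go (ℕ.≤′-step {K} k≤′K)  = subst (_ ∣ₛ_) (ring (z (suc K)) (z K) (z k))
    (S.∣m∣n⇒∣m+n (S.∣-trans p^k∣p^K p^K∣step) (go k≤′K))
    where
    p^K∣step : + (p ^ K) ∣ₛ z (suc K) - z K
    p^K∣step = S.∣ᵤ⇒∣ (padic K)
    p^k∣p^K : + (p ^ k) ∣ₛ + (p ^ K)
    p^k∣p^K = S.∣ᵤ⇒∣ (^-monoʳ-∣ p (ℕP.≤′⇒≤ k≤′K))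
    ring : ∀ a b c → a - b + (b - c) ≡ a - c
    ring = solve-∀

linear-congruence : ∀ {g N b} → Coprime N b → ∀ r c → + g ∣ₛ c - r →
                    ∃ λ x → + (g ℕ.* N) ∣ₛ r + x * + (g ℕ.* b) - c
linear-congruence {g} {N} {b} coprime r c (S.divides w c-r≡wg) with coprime⇒invertible coprime
... | α , S.divides β bα-1≡βN = α * w , S.divides (w * β) (begin
  r + α * w * + (g ℕ.* b) - c      ≡⟨ cong (λ t → r + α * w * t - c) (ℤP.pos-* g b) ⟩
  r + α * w * (+ g * + b) - c      ≡⟨ ring₁ r c (α * w * (+ g * + b)) ⟩
  α * w * (+ g * + b) - (c - r)    ≡⟨ cong (λ t → α * w * (+ g * + b) - t) c-r≡wg ⟩
  α * w * (+ g * + b) - w * + g    ≡⟨ ring₂ α w (+ g) (+ b) ⟩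
  w * + g * (+ b * α - + 1)        ≡⟨ cong (λ t → w * + g * t) bα-1≡βN ⟩
  w * + g * (β * + N)              ≡⟨ ring₃ w β (+ g) (+ N) ⟩
  w * β * (+ g * + N)              ≡⟨ cong (w * β *_) (ℤP.pos-* g N) ⟨
  w * β * + (g ℕ.* N)              ∎)
  where
  open ≡-Reasoning
  ring₁ : ∀ r c u → r + u - c ≡ u - (c - r)
  ring₁ = solve-∀
  ring₂ : ∀ α w g b → α * w * (g * b) - w * g ≡ w * g * (b * α - + 1)
  ring₂ = solve-∀
  ring₃ : ∀ w β g N → w * g * (β * N) ≡ w * β * (g * N)
  ring₃ = solve-∀

module Substitution {P : Poly} {p : ℕ} {zp : ℕ → ℤ} {mp : ℕ} (mp≥1 : 1 ≤ mp) (padic : IsPadic p zp)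
         (low : ∀ j → j < mp → ∀ k → + (p ^ k) ∣ taylorCoeffAt P j (zp k)) where

  ∣ₚ-substitution-near-zero : ∀ n a b → + (p ^ n) ∣ₛ a - zp n → + (p ^ n) ∣ₛ b →
                              + (p ^ (n ℕ.* mp)) ∣ₚ compose P (a ∷ b ∷ [])
  ∣ₚ-substitution-near-zero n a b p^n∣a-z p^n∣b = subst (_∣ₚ compose P (a ∷ b ∷ [])) (pos-^-^ p n mp)
    (∣ₚ-linear-substitution mp P c a b approximate-zero p^n∣a-c p^n∣b)
    where
    c = zp (n ℕ.* mp)
    approximate-zero : ∀ i → i < mp → (+ (p ^ n)) ℤ.^ mp ∣ₛ taylorCoeffAt P i c
    approximate-zero i i<mp =
      subst (_∣ₛ taylorCoeffAt P i c) (sym (pos-^-^ p n mp)) (S.∣ᵤ⇒∣ (low i i<mp (n ℕ.* mp)))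
    p^n∣a-c : + (p ^ n) ∣ₛ a - c
    p^n∣a-c = subst (_ ∣ₛ_) (ring a c (zp n))
      (S.∣m∣n⇒∣m-n p^n∣a-z (padic-coherent {z = zp} padic (ℕP.m≤m*n n mp {{ℕ.>-nonZero mp≥1}})))
      where
      ring : ∀ a c z → a - z - (c - z) ≡ a - c
      ring = solve-∀

  value-divisible : Prime p → ∀ {D e r b} → + (p ^ e) ∣ₛ r - zp e → D ≡ p ^ e ℕ.* b → p ∤ b →
                    ∀ a →
                    ∃ λ x → + (p ^ ((e ℕ.+ a) ℕ.* mp)) ∣ₛ eval (compose P (r ∷ + D ∷ [])) x
  value-divisible p-prime {D} {e} {r} {b} r≡zp refl p∤b a =
    lift (linear-congruence (coprime-prime^ p-prime p∤b a) r (zp n) p^e∣zn-r)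
    where
    n = e ℕ.+ a
    Q = compose P (r ∷ + D ∷ [])
    p^e∣zn-r : + (p ^ e) ∣ₛ zp n - r
    p^e∣zn-r = subst (_ ∣ₛ_) (ring (zp n) (zp e) r)
      (S.∣m∣n⇒∣m-n (padic-coherent {z = zp} padic (ℕP.m≤m+n e a)) r≡zp)
      where
      ring : ∀ c z r → c - z - (r - z) ≡ c - r
      ring = solve-∀
    value-eq : ∀ x → eval (compose P ((r + x * + D) ∷ + 0 ∷ [])) (+ 0) ≡ eval Q x
    value-eq x = begin
      eval (compose P ((r + x * + D) ∷ + 0 ∷ [])) (+ 0)   ≡⟨ eval-compose-linear P _ (+ 0) (+ 0) ⟩
      eval P (r + x * + D + + 0)                         ≡⟨ cong (eval P) (ℤP.+-identityʳ _) ⟩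
      eval P (r + x * + D)                               ≡⟨ eval-compose-linear P r (+ D) x ⟨
      eval Q x                                           ∎
      where open ≡-Reasoning
    lift : (∃ λ x → + (p ^ e ℕ.* p ^ a) ∣ₛ r + x * + D - zp n) →
           ∃ λ x → + (p ^ (n ℕ.* mp)) ∣ₛ eval Q x
    lift (x , p^e*p^a∣r+xD-zn) = x , subst (_ ∣ₛ_) (value-eq x)
      (∣ₚ⇒∣eval _ (+ 0)
        (∣ₚ-substitution-near-zero n (r + x * + D) (+ 0) p^n∣r+xD-zn (S.divides (+ 0) refl)))
      where
      p^n∣r+xD-zn : + (p ^ n) ∣ₛ r + x * + D - zp n
      p^n∣r+xD-zn = subst (λ t → + t ∣ₛ r + x * + D - zp n) (sym (ℕP.^-distribˡ-+-* p e a)) p^e*p^a∣r+xD-zn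

module _ (P : Poly) (z : ℕ → ℕ → ℤ) (m : ℕ → ℕ)
         (padic : ∀ p → Prime p → IsPadic p (z p))
         (m≥1 : ∀ p → Prime p → 1 ≤ m p)
         (multiplicity : ∀ p → Prime p → IsZeroOfMultiplicity p P (z p) (m p))
         (D : ℕ) (D≥1 : 1 ≤ D) (r : ℤ)
         (r≡z : ∀ p → Prime p → + (p ^ ord p D) ∣ r - z p (ord p D)) where

  Q : Poly
  Q = compose P (r ∷ + D ∷ [])

  Aux : Poly
  Aux = auxPoly P m D r

  private
    module Local {p} (p-prime : Prime p) =
      Substitution {P} {p} {z p} {m p} (m≥1 p p-prime) (padic p p-prime) (proj₁ (multiplicity p p-prime))

    r≡zₛ : ∀ {p} → Prime p → + (p ^ ord p D) ∣ₛ r - z p (ord p D)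
    r≡zₛ p-prime = S.∣ᵤ⇒∣ (r≡z _ p-prime)

  lam∣ₚ : + lam m D ∣ₚ Q
  lam∣ₚ = ∣coeff⇒∣ₚ Q (λ j → S.∣ᵤ⇒∣ (lambdaAux-∣ m D (p^exponent∣ j) D))
    where
    p^exponent∣ : ∀ j p → Prime p → p ^ lam-exponent m D p ∣ⁿ ℤ.∣ coeff Q j ∣
    p^exponent∣ j p p-prime with b , D≡p^e*b , _ ← ord-spec p-prime D D≥1 =
      subst (λ k → p ^ k ∣ⁿ ℤ.∣ coeff Q j ∣) (ℕP.*-comm (ord p D) (m p))
        (S.∣⇒∣ᵤ (∣ₚ⇒∣coeff Q p^[em]∣ₚQ j))
      where
      p^e∣D : + (p ^ ord p D) ∣ₛ + D
      p^e∣D = S.∣ᵤ⇒∣ (subst (p ^ ord p D ∣ⁿ_) (sym D≡p^e*b) (ℕD.m∣m*n b))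
      p^[em]∣ₚQ : + (p ^ (ord p D ℕ.* m p)) ∣ₚ Q
      p^[em]∣ₚQ = Local.∣ₚ-substitution-near-zero p-prime (ord p D) r (+ D) (r≡zₛ p-prime) p^e∣D

  eval-auxPoly : ∀ x → eval Q x ≡ eval Aux x * + lam m D
  eval-auxPoly = eval-divBy (lam m D) (lambdaAux-positive m D D) Q lam∣ₚ

  aux-zero-mod-prime-power : ∀ p → Prime p → ∀ a → HasZeroMod Aux (p ^ a)
  aux-zero-mod-prime-power p p-prime a =
    from-factorisations (ord-spec p-prime D D≥1) (lam-split m D D≥1 p-prime)
    where
    from-factorisations : (∃ λ b → D ≡ p ^ ord p D ℕ.* b × p ∤ b) →
                          (∃ λ l → lam m D ≡ p ^ lam-exponent m D p ℕ.* l × p ∤ l) →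
                          HasZeroMod Aux (p ^ a)
    from-factorisations (b , D≡p^e*b , p∤b) (l , lam≡p^k*l , p∤l)
      with x , p^[e+a]m∣Q[x] ← Local.value-divisible p-prime p-prime (r≡zₛ p-prime) D≡p^e*b p∤b a
      = x , prime-power-∣-cancel p-prime p∤l (m≥1 p p-prime)
              (subst (_ ∣ⁿ_) ∣Q[x]∣≡ (S.∣⇒∣ᵤ p^[e+a]m∣Q[x]))
      where
      ∣Q[x]∣≡ : ℤ.∣ eval Q x ∣ ≡ ℤ.∣ eval Aux x ∣ ℕ.* (p ^ lam-exponent m D p ℕ.* l)
      ∣Q[x]∣≡ = begin
        ℤ.∣ eval Q x ∣                              ≡⟨ cong ℤ.∣_∣ (eval-auxPoly x) ⟩
        ℤ.∣ eval Aux x * + lam m D ∣                ≡⟨ ℤP.abs-* (eval Aux x) (+ lam m D) ⟩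
        ℤ.∣ eval Aux x ∣ ℕ.* lam m D                ≡⟨ cong (ℤ.∣ eval Aux x ∣ ℕ.*_) lam≡p^k*l ⟩
        ℤ.∣ eval Aux x ∣ ℕ.* (p ^ lam-exponent m D p ℕ.* l) ∎
        where open ≡-Reasoning

lemma3p7 : (P : Poly) → PositiveDegree P → Intersective P →
           (z : ℕ → ℕ → ℤ) → (m : ℕ → ℕ) →
           ((p : ℕ) → Prime p → IsPadic p (z p)) →
           ((p : ℕ) → Prime p → 1 ≤ m p) →
           ((p : ℕ) → Prime p → IsZeroOfMultiplicity p P (z p) (m p)) →
           (D : ℕ) → 1 ≤ D →
           (r : ℤ) → (- (+ D)) ℤ.< r → r ℤ.≤ + 0 →
           ((p : ℕ) → Prime p → (+ (p ^ ord p D)) ∣ (r - z p (ord p D))) →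
           Intersective (auxPoly P m D r)
lemma3p7 P _ _ z m padic m≥1 multiplicity D D≥1 r _ _ r≡z =
  prime-power-zeros⇒intersective (auxPoly P m D r)
    (aux-zero-mod-prime-power P z m padic m≥1 multiplicity D D≥1 r r≡z)
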